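{- Let $\Gamma$ and $\Sigma$ be graphs with $V(\Sigma)=\{1,\dots,n\}$, $n\ge2$. Then $Q(\Gamma,\Sigma)\cong\mathrm{Aut}_\Sigma(\Gamma)$.
   Context: Graphs are finite and simple. The direct product $\Gamma\times\Sigma$ has vertex set $V(\Gamma)\times V(\Sigma)$, with $(u,x)\sim(v,y)$ iff $u\sim v$ in $\Gamma$ and $x\sim y$ in $\Sigma$. An $n$-tuple $(\alpha_1,\dots,\alpha_n)$ of permutations of $V(\Gamma)$ is a $\Sigma$-automorphism of $\Gamma$ if for all $u,v\in V(\Gamma)$: $\{u,v\}\in E(\Gamma)$ iff $\{u^{\alpha_i},v^{\alpha_j}\}\in E(\Gamma)$ for all $i,j$ with $\{i,j\}\in E(\Sigma)$. The set $\mathrm{Aut}_\Sigma(\Gamma)$ of all $\Sigma$-automorphisms of $\Gamma$ is a group under coordinatewise composition. $Q(\Gamma,\Sigma)=\{\sigma\in\mathrm{Aut}(\Gamma\times\Sigma): (V(\Gamma)\times\{i\})^\sigma=V(\Gamma)\times\{i\}\text{ for each }i\in V(\Sigma)\}$. -}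

module Defs where

open import Data.Nat using (ℕ)
open import Data.Fin using (Fin)
open import Data.Bool using (Bool; true; false; _∧_)
open import Data.Product using (_×_; _,_; proj₁; proj₂; ∃)
open import Function.Bundles using (_↔_; Inverse)
open import Relation.Binary.PropositionalEquality using (_≡_)

record Graph (m : ℕ) : Set where
  field
    adj    : Fin m → Fin m → Bool
    sym    : ∀ u v → adj u v ≡ adj v u
    loopless : ∀ u → adj u u ≡ false
open Graph public

-- Permutations of a set, applied on the right (u^α = to α u).
Perm : Set → Set
Perm A = A ↔ A

app : ∀ {A : Set} → Perm A → A → A
app α = Inverse.to α

app⁻¹ : ∀ {A : Set} → Perm A → A → A
app⁻¹ α = Inverse.from α

_≈ₚ_ : ∀ {A : Set} → Perm A → Perm A → Set
α ≈ₚ β = ∀ x → app α x ≡ app β x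

adj× : ∀ {m n} → Graph m → Graph n → Fin m × Fin n → Fin m × Fin n → Bool
adj× Γ Σ (u , x) (v , y) = adj Γ u v ∧ adj Σ x y

record QElt {m n : ℕ} (Γ : Graph m) (Σ : Graph n) : Set where
  field
    σ      : Perm (Fin m × Fin n)
    isAut  : ∀ x y → adj× Γ Σ x y ≡ adj× Γ Σ (app σ x) (app σ y)
    -- (V(Γ)×{i})^σ ⊆ V(Γ)×{i} and V(Γ)×{i} ⊆ (V(Γ)×{i})^σ
    layer  : ∀ x → proj₂ (app σ x) ≡ proj₂ x
    layer⁻ : ∀ x → proj₂ (app⁻¹ σ x) ≡ proj₂ x
open QElt public

record ΣAut {m n : ℕ} (Γ : Graph m) (Σ : Graph n) : Set where
  field
    α    : Fin n → Perm (Fin m)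
    cond : ∀ i j → adj Σ i j ≡ true →
           ∀ u v → adj Γ u v ≡ adj Γ (app (α i) u) (app (α j) v)
open ΣAut public

_≈Q_ : ∀ {m n} {Γ : Graph m} {Σ : Graph n} → QElt Γ Σ → QElt Γ Σ → Set
s ≈Q t = σ s ≈ₚ σ t

_≈A_ : ∀ {m n} {Γ : Graph m} {Σ : Graph n} → ΣAut Γ Σ → ΣAut Γ Σ → Set
a ≈A b = ∀ i → α a i ≈ₚ α b i

-- Group isomorphism Q(Γ,Σ) ≅ Aut_Σ(Γ): a well-defined bijective map
-- which is a homomorphism (products are composition of permutations in
-- Q, coordinatewise composition in Aut_Σ(Γ); u^{στ} = (u^σ)^τ).
record GroupIso {m n : ℕ} (Γ : Graph m) (Σ : Graph n) : Set where
  field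
    Φ         : QElt Γ Σ → ΣAut Γ Σ
    congΦ     : ∀ s t → s ≈Q t → Φ s ≈A Φ t
    injective : ∀ s t → Φ s ≈A Φ t → s ≈Q t
    surjective : ∀ a → ∃ λ s → Φ s ≈A a
    hom       : ∀ s t r → (∀ x → app (σ r) x ≡ app (σ t) (app (σ s) x)) →
                ∀ i u → app (α (Φ r) i) u ≡ app (α (Φ t) i) (app (α (Φ s) i) u)

-- A layer-preserving permutation σ of V(Γ) × V(Σ) is the same thing as the
-- family (αᵢ)ᵢ of its restrictions to the layers V(Γ) × {i}, and composition
-- of such permutations is layerwise.  Edges of Γ × Σ only join layers i, j with
-- i ~ j in Σ, and between such layers (u,i) ~ (v,j) iff u ~ v in Γ; so σ is an
-- automorphism of Γ × Σ exactly when (αᵢ)ᵢ is a Σ-automorphism of Γ.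
module Submission where

open import Defs hiding (sym)
open import Data.Nat using (ℕ; _≤_)
open import Data.Bool using (true; false; _∧_)
open import Data.Bool.Properties using (∧-identityʳ; ∧-zeroʳ)
open import Data.Product using (_×_; _,_; proj₁; proj₂)
open import Function.Bundles using (Inverse; mk↔ₛ′)
open import Relation.Binary.PropositionalEquality

≡-proj₁, : ∀ {A B : Set} (p : A × B) {i : B} → proj₂ p ≡ i → p ≡ (proj₁ p , i)
≡-proj₁, p refl = refl

fibrewise : ∀ {A B : Set} → (B → Perm A) → Perm (A × B)
fibrewise α = mk↔ₛ′ (λ (u , i) → app (α i) u , i) (λ (u , i) → app⁻¹ (α i) u , i)
  (λ (u , i) → cong (_, i) (Inverse.strictlyInverseˡ (α i) u))
  (λ (u , i) → cong (_, i) (Inverse.strictlyInverseʳ (α i) u))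

module FibrePreserving {A B : Set} (σ : Perm (A × B))
  (pres : ∀ x → proj₂ (app σ x) ≡ proj₂ x)
  (pres⁻ : ∀ x → proj₂ (app⁻¹ σ x) ≡ proj₂ x) where

  restrict : B → Perm A
  restrict i = mk↔ₛ′ (λ u → proj₁ (app σ (u , i))) (λ u → proj₁ (app⁻¹ σ (u , i)))
    (λ u → trans (cong (λ p → proj₁ (app σ p)) (sym (≡-proj₁, _ (pres⁻ (u , i)))))
                 (cong proj₁ (Inverse.strictlyInverseˡ σ (u , i))))
    (λ u → trans (cong (λ p → proj₁ (app⁻¹ σ p)) (sym (≡-proj₁, _ (pres (u , i)))))
                 (cong proj₁ (Inverse.strictlyInverseʳ σ (u , i))))

  app-restrict : ∀ u i → app σ (u , i) ≡ (app (restrict i) u , i)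
  app-restrict u i = ≡-proj₁, _ (pres (u , i))

module _ {m n : ℕ} (Γ : Graph m) (Σ : Graph n) where

  adj×-edge : ∀ {i j} → adj Σ i j ≡ true → ∀ u v → adj× Γ Σ (u , i) (v , j) ≡ adj Γ u v
  adj×-edge i~j u v = trans (cong (adj Γ u v ∧_) i~j) (∧-identityʳ (adj Γ u v))

  module Layers (s : QElt Γ Σ) = FibrePreserving (σ s) (layer s) (layer⁻ s)
  open Layers using (restrict; app-restrict)

  restrict-ΣAut : QElt Γ Σ → ΣAut Γ Σ
  restrict-ΣAut s = record { α = restrict s ; cond = cond′ }
    where
    cond′ : ∀ i j → adj Σ i j ≡ true →
            ∀ u v → adj Γ u v ≡ adj Γ (app (restrict s i) u) (app (restrict s j) v)
    cond′ i j i~j u v = begin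
      adj Γ u v                                           ≡⟨ sym (adj×-edge i~j u v) ⟩
      adj× Γ Σ (u , i) (v , j)                            ≡⟨ isAut s (u , i) (v , j) ⟩
      adj× Γ Σ (app (σ s) (u , i)) (app (σ s) (v , j))    ≡⟨ cong₂ (adj× Γ Σ) (app-restrict s u i) (app-restrict s v j) ⟩
      adj× Γ Σ (app (restrict s i) u , i) (app (restrict s j) v , j)
                                                          ≡⟨ adj×-edge i~j _ _ ⟩
      adj Γ (app (restrict s i) u) (app (restrict s j) v) ∎
      where open ≡-Reasoning

  fibrewise-isAut : ∀ (a : ΣAut Γ Σ) x y →
    adj× Γ Σ x y ≡ adj× Γ Σ (app (fibrewise (α a)) x) (app (fibrewise (α a)) y)
  fibrewise-isAut a (u , i) (v , j) with adj Σ i j in i~j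
  ... | true  = cong (_∧ true) (cond a i j i~j u v)
  ... | false = trans (∧-zeroʳ _) (sym (∧-zeroʳ _))

  fibrewise-QElt : ΣAut Γ Σ → QElt Γ Σ
  fibrewise-QElt a = record
    { σ = fibrewise (α a) ; isAut = fibrewise-isAut a ; layer = λ _ → refl ; layer⁻ = λ _ → refl }

  restrict-injective : ∀ s t → restrict-ΣAut s ≈A restrict-ΣAut t → s ≈Q t
  restrict-injective s t s≈t (u , i) = begin
    app (σ s) (u , i)          ≡⟨ app-restrict s u i ⟩
    app (restrict s i) u , i   ≡⟨ cong (_, i) (s≈t i u) ⟩
    app (restrict t i) u , i   ≡⟨ sym (app-restrict t u i) ⟩
    app (σ t) (u , i)          ∎
    where open ≡-Reasoning

  restrict-hom : ∀ s t r → (∀ x → app (σ r) x ≡ app (σ t) (app (σ s) x)) →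
    ∀ i u → app (restrict r i) u ≡ app (restrict t i) (app (restrict s i) u)
  restrict-hom s t r r≡st i u = begin
    proj₁ (app (σ r) (u , i))                        ≡⟨ cong proj₁ (r≡st (u , i)) ⟩
    proj₁ (app (σ t) (app (σ s) (u , i)))            ≡⟨ cong (λ p → proj₁ (app (σ t) p)) (app-restrict s u i) ⟩
    proj₁ (app (σ t) (app (restrict s i) u , i))     ∎
    where open ≡-Reasoning

lemma2p2 : ∀ {m n : ℕ} → 2 ≤ n → (Γ : Graph m) → (Σ : Graph n) → GroupIso Γ Σ
lemma2p2 _ Γ Σ = record
  { Φ          = restrict-ΣAut Γ Σ
  ; congΦ      = λ s t s≈t i u → cong proj₁ (s≈t (u , i))
  ; injective  = restrict-injective Γ Σ
  ; surjective = λ a → fibrewise-QElt Γ Σ a , λ i u → refl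
  ; hom        = restrict-hom Γ Σ
  }
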